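{- Let $X=a_1a_2\cdots a_k$ be a Universal Cycle for $3$-subsets of $[n]$. Call an unordered pair $\{a,b\}$ of distinct elements of $[n]$ missing if there is no index $i$ with $\{a_i,a_{i+1}\}=\{a,b\}$ (indices taken cyclically modulo $k$). Then no two distinct missing pairs have an element in common. Consequently, $X$ has at most $n/2$ missing pairs.
   Context: A Universal Cycle for $3$-subsets of $[n]=\{1,\ldots,n\}$ is a cyclic sequence $a_1\cdots a_k$ of $k=\binom{n}{3}$ entries from $[n]$ such that every $3$-element subset of $[n]$ appears exactly once as the set $\{a_i,a_{i+1},a_{i+2}\}$ of three cyclically consecutive entries (indices modulo $k$). -}

module Defs where

open import Data.Nat using (ℕ; zero; suc; _+_; _*_; _≤_; NonZero)
open import Data.Nat.Combinatorics using (_C_)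
open import Data.Fin using (Fin; toℕ; fromℕ<)
open import Data.Fin.Subset using (Subset; ⁅_⁆; _∪_; ∣_∣)
open import Data.Nat.DivMod using (_%_; m%n<n)
open import Data.Product using (Σ; _×_; _,_; ∃)
open import Relation.Binary.PropositionalEquality using (_≡_)
open import Relation.Nullary using (¬_)

next : {k : ℕ} → Fin k → Fin k
next {suc k} i = fromℕ< (m%n<n (suc (toℕ i)) (suc k))

-- a cyclic sequence of length k over [n] (here [n] is modelled by Fin n)
Cycle : ℕ → ℕ → Set
Cycle n k = Fin k → Fin n

window3 : {n k : ℕ} → Cycle n k → Fin k → Subset n
window3 X i = ⁅ X i ⁆ ∪ (⁅ X (next i) ⁆ ∪ ⁅ X (next (next i)) ⁆)

window2 : {n k : ℕ} → Cycle n k → Fin k → Subset n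
window2 X i = ⁅ X i ⁆ ∪ ⁅ X (next i) ⁆

IsUCycle3 : (n : ℕ) → Cycle n (n C 3) → Set
IsUCycle3 n X =
  (S : Subset n) → ∣ S ∣ ≡ 3 →
    Σ (Fin (n C 3)) λ i → (window3 X i ≡ S) × ((j : Fin (n C 3)) → window3 X j ≡ S → j ≡ i)

Missing : {n k : ℕ} → Cycle n k → Subset n → Set
Missing X P = (∣ P ∣ ≡ 2) × ((i : _) → ¬ (window2 X i ≡ P))

-- Two missing pairs {x,y} ≠ {x,z} sharing x make {x,y,z} a 3-subset, so it occurs as a window
-- a_i a_{i+1} a_{i+2} of X.  The entries of that window are pairwise distinct, and x sits next
-- to another entry of it, namely y or z; this adjacency contradicts missingness.  Pairwise
-- disjoint 2-subsets of [n] number at most n/2.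
module Submission where

open import Defs
open import Data.Nat using (ℕ; _*_; _≤_)
open import Data.Nat.Combinatorics using (_C_)
open import Data.Fin.Subset using (Subset; _∈_)
open import Data.List using (List; length)
open import Data.List.Relation.Unary.All using (All)
open import Data.List.Relation.Unary.Unique.Propositional using (Unique)
open import Data.Product using (_×_)
open import Relation.Binary.PropositionalEquality using (_≡_)
open import Relation.Nullary using (¬_)

open import Data.Nat using (suc; _+_)
open import Data.Nat.Properties using (suc-injective; +-suc; *-suc; *-zeroʳ; module ≤-Reasoning)
open import Data.Bool using (true; false)
open import Data.Fin using (Fin; zero; suc)
import Data.Fin.Properties as Fin
open import Data.Fin.Subset using (⁅_⁆; _∪_; ∣_∣; ⊥; _∉_; ⋃)
open import Data.Fin.Subset.Properties
  using (∪-comm; ∪-identityˡ; x∈p∪q⁻; x∈p∪q⁺; x∈⁅x⁆; x∈⁅y⁆⇒x≡y; ∣p∣≤n; ∉⊥; ∣⊥∣≡0; ∣⁅x⁆∣≡1)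
open import Data.Vec using ([]; _∷_; here; there)
open import Data.List using ([]; _∷_)
open import Data.List.Relation.Unary.All using ([]; _∷_)
import Data.List.Relation.Unary.All as All
open import Data.List.Relation.Unary.AllPairs using (AllPairs; []; _∷_)
open import Data.Product using (∃; ∃₂; _,_; proj₁)
open import Data.Sum using (_⊎_; inj₁; inj₂)
open import Data.Empty using (⊥-elim)
open import Relation.Binary.PropositionalEquality using (refl; sym; trans; cong; cong₂; subst; _≢_; module ≡-Reasoning)

private
  variable
    n k : ℕ
    t x y z u v w : Fin n

pair : Fin n → Fin n → Subset n
pair x y = ⁅ x ⁆ ∪ ⁅ y ⁆

triple : Fin n → Fin n → Fin n → Subset n
triple x y z = ⁅ x ⁆ ∪ pair y z

Disjoint : Subset n → Subset n → Set
Disjoint p q = ∀ x → ¬ (x ∈ p × x ∈ q)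

x∈pair : (x y : Fin n) → x ∈ pair x y
x∈pair x y = x∈p∪q⁺ (inj₁ (x∈⁅x⁆ x))

y∈pair : (x y : Fin n) → y ∈ pair x y
y∈pair x y = x∈p∪q⁺ {p = ⁅ x ⁆} (inj₂ (x∈⁅x⁆ y))

x∈pair⁺ : x ≡ u ⊎ x ≡ v → x ∈ pair u v
x∈pair⁺ {v = v} (inj₁ refl) = x∈pair _ v
x∈pair⁺ {u = u} (inj₂ refl) = y∈pair u _

x∈pair⁻ : x ∈ pair y z → x ≡ y ⊎ x ≡ z
x∈pair⁻ {y = y} {z = z} x∈ with x∈p∪q⁻ ⁅ y ⁆ ⁅ z ⁆ x∈
... | inj₁ x∈⁅y⁆ = inj₁ (x∈⁅y⁆⇒x≡y y x∈⁅y⁆)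
... | inj₂ x∈⁅z⁆ = inj₂ (x∈⁅y⁆⇒x≡y z x∈⁅z⁆)

x∈triple : (x y z : Fin n) → x ∈ triple x y z
x∈triple x y z = x∈p∪q⁺ (inj₁ (x∈⁅x⁆ x))

y∈triple : (x y z : Fin n) → y ∈ triple x y z
y∈triple x y z = x∈p∪q⁺ {p = ⁅ x ⁆} (inj₂ (x∈pair y z))

z∈triple : (x y z : Fin n) → z ∈ triple x y z
z∈triple x y z = x∈p∪q⁺ {p = ⁅ x ⁆} (inj₂ (y∈pair y z))

x∈triple⁻ : x ∈ triple u v w → x ≡ u ⊎ x ≡ v ⊎ x ≡ w
x∈triple⁻ {u = u} x∈ with x∈p∪q⁻ ⁅ u ⁆ _ x∈
... | inj₁ x∈⁅u⁆ = inj₁ (x∈⁅y⁆⇒x≡y u x∈⁅u⁆)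
... | inj₂ x∈⁅v,w⁆ = inj₂ (x∈pair⁻ x∈⁅v,w⁆)

∣p∣≡0⇒p≡⊥ : (p : Subset n) → ∣ p ∣ ≡ 0 → p ≡ ⊥
∣p∣≡0⇒p≡⊥ [] _ = refl
∣p∣≡0⇒p≡⊥ (false ∷ p) ∣p∣≡0 = cong (false ∷_) (∣p∣≡0⇒p≡⊥ p ∣p∣≡0)

∣p∣≡1⇒p≡⁅x⁆ : (p : Subset n) → ∣ p ∣ ≡ 1 → ∃ λ x → p ≡ ⁅ x ⁆
∣p∣≡1⇒p≡⁅x⁆ (true ∷ p) ∣p∣≡1 = zero , cong (true ∷_) (∣p∣≡0⇒p≡⊥ p (suc-injective ∣p∣≡1))
∣p∣≡1⇒p≡⁅x⁆ (false ∷ p) ∣p∣≡1 with ∣p∣≡1⇒p≡⁅x⁆ p ∣p∣≡1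
... | x , refl = suc x , refl

∣p∣≡2⇒p≡pair : (p : Subset n) → ∣ p ∣ ≡ 2 → ∃₂ λ x y → x ≢ y × p ≡ pair x y
∣p∣≡2⇒p≡pair (true ∷ p) ∣p∣≡2 with ∣p∣≡1⇒p≡⁅x⁆ p (suc-injective ∣p∣≡2)
... | y , refl = zero , suc y , (λ ()) , cong (true ∷_) (sym (∪-identityˡ _))
∣p∣≡2⇒p≡pair (false ∷ p) ∣p∣≡2 with ∣p∣≡2⇒p≡pair p ∣p∣≡2
... | x , y , x≢y , refl = suc x , suc y , (λ sx≡sy → x≢y (Fin.suc-injective sx≡sy)) , refl

∣p∣≡2∧x∈p⇒p≡pair : (p : Subset n) → ∣ p ∣ ≡ 2 → x ∈ p → ∃ λ y → y ≢ x × p ≡ pair x y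
∣p∣≡2∧x∈p⇒p≡pair p ∣p∣≡2 x∈p with ∣p∣≡2⇒p≡pair p ∣p∣≡2
... | y , z , y≢z , refl with x∈pair⁻ x∈p
...   | inj₁ refl = z , (λ z≡y → y≢z (sym z≡y)) , refl
...   | inj₂ refl = y , y≢z , ∪-comm ⁅ y ⁆ ⁅ z ⁆

∣⁅x⁆∪p∣≡1+∣p∣ : (x : Fin n) (p : Subset n) → x ∉ p → ∣ ⁅ x ⁆ ∪ p ∣ ≡ suc ∣ p ∣
∣⁅x⁆∪p∣≡1+∣p∣ zero (true ∷ p) x∉p = ⊥-elim (x∉p here)
∣⁅x⁆∪p∣≡1+∣p∣ zero (false ∷ p) _ = cong (λ q → suc ∣ q ∣) (∪-identityˡ p)
∣⁅x⁆∪p∣≡1+∣p∣ (suc x) (true ∷ p) x∉p = cong suc (∣⁅x⁆∪p∣≡1+∣p∣ x p (λ x∈p → x∉p (there x∈p)))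
∣⁅x⁆∪p∣≡1+∣p∣ (suc x) (false ∷ p) x∉p = ∣⁅x⁆∪p∣≡1+∣p∣ x p (λ x∈p → x∉p (there x∈p))

∣triple∣≡3 : x ≢ y → x ≢ z → y ≢ z → ∣ triple x y z ∣ ≡ 3
∣triple∣≡3 {x = x} {y} {z} x≢y x≢z y≢z = begin
  ∣ ⁅ x ⁆ ∪ pair y z ∣  ≡⟨ ∣⁅x⁆∪p∣≡1+∣p∣ x (pair y z) x∉pair ⟩
  suc ∣ ⁅ y ⁆ ∪ ⁅ z ⁆ ∣ ≡⟨ cong suc (∣⁅x⁆∪p∣≡1+∣p∣ y ⁅ z ⁆ (λ y∈⁅z⁆ → y≢z (x∈⁅y⁆⇒x≡y z y∈⁅z⁆))) ⟩
  suc (suc ∣ ⁅ z ⁆ ∣)   ≡⟨ cong (λ m → suc (suc m)) (∣⁅x⁆∣≡1 z) ⟩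
  3                     ∎
  where
  open ≡-Reasoning

  x∉pair : x ∉ pair y z
  x∉pair x∈ with x∈pair⁻ x∈
  ... | inj₁ x≡y = x≢y x≡y
  ... | inj₂ x≡z = x≢z x≡z

Disjoint-tail : ∀ {s t} {p q : Subset n} → Disjoint (s ∷ p) (t ∷ q) → Disjoint p q
Disjoint-tail sp⊥tq x (x∈p , x∈q) = sp⊥tq (suc x) (there x∈p , there x∈q)

∣p∪q∣≡∣p∣+∣q∣ : (p q : Subset n) → Disjoint p q → ∣ p ∪ q ∣ ≡ ∣ p ∣ + ∣ q ∣
∣p∪q∣≡∣p∣+∣q∣ [] [] _ = refl
∣p∪q∣≡∣p∣+∣q∣ (true ∷ p) (true ∷ q) p⊥q = ⊥-elim (p⊥q zero (here , here))
∣p∪q∣≡∣p∣+∣q∣ (true ∷ p) (false ∷ q) p⊥q = cong suc (∣p∪q∣≡∣p∣+∣q∣ p q (Disjoint-tail p⊥q))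
∣p∪q∣≡∣p∣+∣q∣ (false ∷ p) (true ∷ q) p⊥q = begin
  suc ∣ p ∪ q ∣     ≡⟨ cong suc (∣p∪q∣≡∣p∣+∣q∣ p q (Disjoint-tail p⊥q)) ⟩
  suc (∣ p ∣ + ∣ q ∣) ≡⟨ sym (+-suc ∣ p ∣ ∣ q ∣) ⟩
  ∣ p ∣ + suc ∣ q ∣   ∎
  where open ≡-Reasoning
∣p∪q∣≡∣p∣+∣q∣ (false ∷ p) (false ∷ q) p⊥q = ∣p∪q∣≡∣p∣+∣q∣ p q (Disjoint-tail p⊥q)

Disjoint-⋃ : {p : Subset n} (qs : List (Subset n)) → All (Disjoint p) qs → Disjoint p (⋃ qs)
Disjoint-⋃ [] [] x (_ , x∈⊥) = ∉⊥ x∈⊥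
Disjoint-⋃ (q ∷ qs) (p⊥q ∷ p⊥qs) x (x∈p , x∈q∪qs) with x∈p∪q⁻ q (⋃ qs) x∈q∪qs
... | inj₁ x∈q  = p⊥q x (x∈p , x∈q)
... | inj₂ x∈qs = Disjoint-⋃ qs p⊥qs x (x∈p , x∈qs)

∣⋃ps∣≡k*length : (ps : List (Subset n)) → AllPairs Disjoint ps → All (λ p → ∣ p ∣ ≡ k) ps →
  ∣ ⋃ ps ∣ ≡ k * length ps
∣⋃ps∣≡k*length {n = n} {k = k} [] [] [] = trans (∣⊥∣≡0 n) (sym (*-zeroʳ k))
∣⋃ps∣≡k*length {k = k} (p ∷ ps) (p⊥ps ∷ ps-disjoint) (∣p∣≡k ∷ ∣ps∣≡k) = begin
  ∣ p ∪ ⋃ ps ∣       ≡⟨ ∣p∪q∣≡∣p∣+∣q∣ p (⋃ ps) (Disjoint-⋃ ps p⊥ps) ⟩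
  ∣ p ∣ + ∣ ⋃ ps ∣    ≡⟨ cong₂ _+_ ∣p∣≡k (∣⋃ps∣≡k*length ps ps-disjoint ∣ps∣≡k) ⟩
  k + k * length ps  ≡⟨ sym (*-suc k (length ps)) ⟩
  k * suc (length ps) ∎
  where open ≡-Reasoning

three-distinct-∉-pair : x ≢ y → x ≢ z → y ≢ z →
  x ∈ pair u v → y ∈ pair u v → ¬ z ∈ pair u v
three-distinct-∉-pair x≢y x≢z y≢z x∈ y∈ z∈
  with x∈pair⁻ x∈ | x∈pair⁻ y∈ | x∈pair⁻ z∈
... | inj₁ refl | inj₁ refl | _         = x≢y refl
... | inj₂ refl | inj₂ refl | _         = x≢y refl
... | inj₁ refl | _         | inj₁ refl = x≢z refl
... | inj₂ refl | _         | inj₂ refl = x≢z refl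
... | _         | inj₁ refl | inj₁ refl = y≢z refl
... | _         | inj₂ refl | inj₂ refl = y≢z refl

triple-entries-distinct : x ≢ y → x ≢ z → y ≢ z → triple u v w ≡ triple x y z → u ≢ v × v ≢ w
triple-entries-distinct {x = x} {y} {z} {u = u} {v = v} {w = w} x≢y x≢z y≢z uvw≡xyz = u≢v , v≢w
  where
  x∈ : x ∈ triple u v w
  x∈ = subst (x ∈_) (sym uvw≡xyz) (x∈triple x y z)
  y∈ : y ∈ triple u v w
  y∈ = subst (y ∈_) (sym uvw≡xyz) (y∈triple x y z)
  z∈ : z ∈ triple u v w
  z∈ = subst (z ∈_) (sym uvw≡xyz) (z∈triple x y z)

  ∈uuw⇒∈uw : t ∈ triple u u w → t ∈ pair u w
  ∈uuw⇒∈uw t∈ with x∈triple⁻ t∈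
  ... | inj₁ t≡u        = x∈pair⁺ (inj₁ t≡u)
  ... | inj₂ (inj₁ t≡u) = x∈pair⁺ (inj₁ t≡u)
  ... | inj₂ (inj₂ t≡w) = x∈pair⁺ (inj₂ t≡w)

  ∈uvv⇒∈uv : t ∈ triple u v v → t ∈ pair u v
  ∈uvv⇒∈uv t∈ with x∈triple⁻ t∈
  ... | inj₁ t≡u        = x∈pair⁺ (inj₁ t≡u)
  ... | inj₂ (inj₁ t≡v) = x∈pair⁺ (inj₂ t≡v)
  ... | inj₂ (inj₂ t≡v) = x∈pair⁺ (inj₂ t≡v)

  u≢v : u ≢ v
  u≢v refl = three-distinct-∉-pair x≢y x≢z y≢z (∈uuw⇒∈uw x∈) (∈uuw⇒∈uw y∈) (∈uuw⇒∈uw z∈)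

  v≢w : v ≢ w
  v≢w refl = three-distinct-∉-pair x≢y x≢z y≢z (∈uvv⇒∈uv x∈) (∈uvv⇒∈uv y∈) (∈uvv⇒∈uv z∈)

window3-neighbour : (X : Cycle n k) (i : Fin k) →
  X i ≢ X (next i) → X (next i) ≢ X (next (next i)) → x ∈ window3 X i →
  ∃₂ λ j w → w ≢ x × w ∈ window3 X i × window2 X j ≡ pair x w
window3-neighbour X i a≢b b≢c x∈ with x∈triple⁻ x∈
... | inj₁ refl =
  i , X (next i) , (λ b≡a → a≢b (sym b≡a)) , y∈triple (X i) _ _ , refl
... | inj₂ (inj₁ refl) =
  i , X i , a≢b , x∈triple _ _ _ , ∪-comm ⁅ X i ⁆ ⁅ X (next i) ⁆
... | inj₂ (inj₂ refl) =
  next i , X (next i) , b≢c , y∈triple (X i) _ _ , ∪-comm ⁅ X (next i) ⁆ ⁅ X (next (next i)) ⁆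

one-of-two-pairs-adjacent : {X : Cycle n (n C 3)} → IsUCycle3 n X → x ≢ y → x ≢ z → y ≢ z →
  ∃ λ j → window2 X j ≡ pair x y ⊎ window2 X j ≡ pair x z
one-of-two-pairs-adjacent {x = x} {y} {z} {X = X} U x≢y x≢z y≢z
  with U (triple x y z) (∣triple∣≡3 x≢y x≢z y≢z)
... | i , window≡xyz , _
  with triple-entries-distinct x≢y x≢z y≢z window≡xyz
... | a≢b , b≢c
  with window3-neighbour X i a≢b b≢c (subst (x ∈_) (sym window≡xyz) (x∈triple x y z))
... | j , w , w≢x , w∈window , window2≡xw
  with x∈triple⁻ (subst (w ∈_) window≡xyz w∈window)
... | inj₁ refl        = ⊥-elim (w≢x refl)
... | inj₂ (inj₁ refl) = j , inj₁ window2≡xw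
... | inj₂ (inj₂ refl) = j , inj₂ window2≡xw

missing-pairs-disjoint : {X : Cycle n (n C 3)} → IsUCycle3 n X → {P Q : Subset n} →
  Missing X P → Missing X Q → P ≢ Q → Disjoint P Q
missing-pairs-disjoint U (∣P∣≡2 , P-missing) (∣Q∣≡2 , Q-missing) P≢Q x (x∈P , x∈Q)
  with ∣p∣≡2∧x∈p⇒p≡pair _ ∣P∣≡2 x∈P | ∣p∣≡2∧x∈p⇒p≡pair _ ∣Q∣≡2 x∈Q
... | y , y≢x , refl | z , z≢x , refl
  with one-of-two-pairs-adjacent U (λ x≡y → y≢x (sym x≡y)) (λ x≡z → z≢x (sym x≡z))
                                   (λ { refl → P≢Q refl })
... | j , inj₁ window≡P = P-missing j window≡P
... | j , inj₂ window≡Q = Q-missing j window≡Q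

missing-pairs-pairwise-disjoint : {X : Cycle n (n C 3)} → IsUCycle3 n X →
  (Ps : List (Subset n)) → Unique Ps → All (Missing X) Ps → AllPairs Disjoint Ps
missing-pairs-pairwise-disjoint U [] [] [] = []
missing-pairs-pairwise-disjoint U (P ∷ Ps) (P≢Ps ∷ Ps-unique) (P-missing ∷ Ps-missing) =
  All.zipWith (λ { (P≢Q , Q-missing) → missing-pairs-disjoint U P-missing Q-missing P≢Q })
              (P≢Ps , Ps-missing)
  ∷ missing-pairs-pairwise-disjoint U Ps Ps-unique Ps-missing

claim10 : (n : ℕ) (X : Cycle n (n C 3)) → IsUCycle3 n X →
    ((P Q : Subset n) → Missing X P → Missing X Q → ¬ (P ≡ Q) →
      (x : _) → ¬ ((x ∈ P) × (x ∈ Q)))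
    × ((Ps : List (Subset n)) → Unique Ps → All (Missing X) Ps → 2 * length Ps ≤ n)
claim10 n X U = (λ P Q → missing-pairs-disjoint U) , at-most-n/2
  where
  at-most-n/2 : (Ps : List (Subset n)) → Unique Ps → All (Missing X) Ps → 2 * length Ps ≤ n
  at-most-n/2 Ps Ps-unique Ps-missing = begin
    2 * length Ps ≡⟨ ∣⋃ps∣≡k*length Ps (missing-pairs-pairwise-disjoint U Ps Ps-unique Ps-missing)
                                       (All.map proj₁ Ps-missing) ⟨
    ∣ ⋃ Ps ∣      ≤⟨ ∣p∣≤n (⋃ Ps) ⟩
    n             ∎
    where open ≤-Reasoning
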